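{- Let $n\ge 3$ and let $\boldsymbol{\pi}\in\mathfrak{S}_n$ be of the form $2Ln1$, i.e. $\pi_1=2$, $\pi_{n-1}=n$, $\pi_n=1$, and $L$ is any permutation of $\{3,4,\dots,n-1\}$. Then the simplex $\triangle:=\operatorname{conv}(\mathcal{S}^{\boldsymbol{\pi}})$ is hollow (contains no lattice points in its relative interior). In particular, any non-vertex lattice point of $\triangle$ lies on the facet $\operatorname{conv}(\mathcal{S}^{\boldsymbol{\pi}}\setminus\{\mathbf{e}\})$.
   Context: Permutations are identified with points of $\mathbb{R}^n$; $\mathbf{e}=12\cdots n$. The stack-sorting map $s$: start with an empty stack and read entries left to right; for each entry $x$, while the stack is nonempty and its top $t<x$, pop $t$ to the output; then push $x$. At the end, pop the remaining stack elements to the output; the output is $s(\boldsymbol{\pi})$. $\mathcal{S}^{\boldsymbol{\pi}}=\{\boldsymbol{\pi},s(\boldsymbol{\pi}),s^2(\boldsymbol{\pi}),\dots,\mathbf{e}\}$ (iterating until $\mathbf{e}$ is reached); its convex hull is an $(n-1)$-simplex with these $n$ points as vertices.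
   Formalization: The convex-combination weights that describe membership in $\triangle$, in its relative interior and in the facet are rational rather than real. -}

module Defs where

open import Data.Nat as ℕ using (ℕ; zero; suc; _<ᵇ_)
open import Data.Bool using (if_then_else_)
open import Data.Integer as ℤ using (ℤ; +_)
open import Data.Rational as ℚ using (ℚ; 0ℚ; 1ℚ; _/_)
open import Data.List using (List; []; _∷_; _++_; map; upTo; zipWith; replicate; foldr; zip; length; reverse)
open import Data.List.Relation.Unary.All using (All)
open import Data.List.Properties using (≡-dec)
open import Data.Product using (Σ; _×_; _,_)
open import Relation.Binary.PropositionalEquality using (_≡_)
open import Relation.Nullary.Decidable using (does)

-- Permutations of {1,…,n} are lists of naturals (one-line notation).
-- The identity permutation e = 1 2 ⋯ n.
ident : ℕ → List ℕ
ident n = map suc (upTo n)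

popSmaller : ℕ → List ℕ → List ℕ → List ℕ × List ℕ
popSmaller x []      out = [] , out
popSmaller x (t ∷ st) out =
  if t <ᵇ x then popSmaller x st (out ++ (t ∷ [])) else (t ∷ st , out)

stackRun : List ℕ → List ℕ → List ℕ → List ℕ
stackRun []       st out = out ++ st
stackRun (x ∷ xs) st out with popSmaller x st out
... | st' , out' = stackRun xs (x ∷ st') out'

stackSort : List ℕ → List ℕ
stackSort π = stackRun π [] []

-- Iterate s until the identity e (of length n) is reached, with fuel.
-- s^(n-1) is always e, so fuel n suffices.
orbitFuel : ℕ → ℕ → List ℕ → List (List ℕ)
orbitFuel n zero    p = p ∷ []
orbitFuel n (suc k) p =
  if does (≡-dec ℕ._≟_ p (ident n)) then p ∷ [] else p ∷ orbitFuel n k (stackSort p)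

orbit : ℕ → List ℕ → List (List ℕ)
orbit n π = orbitFuel n n π

ℕtoℚ : ℕ → ℚ
ℕtoℚ k = (+ k) / 1

ℤtoℚ : ℤ → ℚ
ℤtoℚ z = z / 1

combo : ℕ → List ℚ → List (List ℕ) → List ℚ
combo n ws vs =
  foldr (λ { (w , v) acc → zipWith ℚ._+_ (map (λ k → w ℚ.* ℕtoℚ k) v) acc })
        (replicate n 0ℚ) (zip ws vs)

CombWith : (ℚ → Set) → ℕ → List (List ℕ) → List ℚ → Set
CombWith P n vs x =
  Σ (List ℚ) λ ws →
    (length ws ≡ length vs) × All P ws × (foldr ℚ._+_ 0ℚ ws ≡ 1ℚ) × (combo n ws vs ≡ x)

InConv : ℕ → List (List ℕ) → List ℚ → Set
InConv = CombWith (λ w → 0ℚ ℚ.≤ w)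

-- x in the relative interior of conv(vs): a convex combination with all
-- weights strictly positive (valid characterization for the convex hull of
-- a finite point set).
InRelInt : ℕ → List (List ℕ) → List ℚ → Set
InRelInt = CombWith (λ w → 0ℚ ℚ.< w)

latt : List ℤ → List ℚ
latt x = map ℤtoℚ x

midRange : ℕ → List ℕ
midRange n = map (λ i → 3 ℕ.+ i) (upTo (n ℕ.∸ 3))

{-# OPTIONS --safe #-}
module Submission where

-- Every point of 𝒮^π other than e begins with 2, while e begins with 1. Indeed, stack-sorting
-- 2 A K 1 B, where the entries of A lie strictly between 2 and K and B increases from above K,
-- gives 2 s(A) 1 K B, and s(A) again ends with its maximum; so 2 stays in front until the last
-- step yields e. Hence the first coordinate of a convex combination of 𝒮^π is 1 + E, where E is
-- the total weight off e. In the relative interior 0 < E < 1, so the point is not integral. For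
-- a lattice point E is 0 or 1: E = 0 makes the point e itself, and E = 1 leaves no weight on e.

open import Defs
open import Data.Nat as ℕ using (ℕ; zero; suc; _+_; _≤_; _<_; _<ᵇ_; z≤n; s≤s)
import Data.Nat.Properties as ℕP
open ℕP using (_≟_)
open import Data.Nat.GCD using (gcd-zeroʳ)
open import Data.Integer as ℤ using (ℤ; +_; -[1+_]; +<+; +≤+)
import Data.Integer.Properties as ℤP
open import Data.Integer.GCD using () renaming (gcd to gcdℤ)
open import Data.Rational as ℚ using (ℚ; 0ℚ; 1ℚ; ↥_; ↧_)
import Data.Rational.Properties as ℚP
open import Data.Rational.Solver using (module +-*-Solver)
open import Algebra.Properties.Group ℚP.+-0-group using (∙-cancelˡ; ∙-cancelʳ)
open import Data.Bool using (true; false; if_then_else_)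
open import Data.Empty using (⊥; ⊥-elim)
open import Data.List using (List; []; _∷_; _++_; [_]; _∷ʳ_; map; length; replicate; zipWith; foldr; filter; applyUpTo)
open import Data.List.Properties
  using (++-assoc; ++-identityʳ; ≡-dec; ∷-injectiveˡ; length-map; length-++; length-replicate; length-zipWith; map-cong; map-∘; map-injective; map-upTo)
open import Data.List.Relation.Unary.All as All using (All; []; _∷_)
import Data.List.Relation.Unary.All.Properties as AllP
open import Data.List.Relation.Unary.Any as Any using (Any; here; there)
open import Data.List.Relation.Unary.Linked using (Linked; []; [-]; _∷_)
open import Data.List.Relation.Binary.Pointwise using (Pointwise; []; _∷_)
open import Data.List.Membership.Propositional using (_∈_)
open import Data.List.Membership.Propositional.Properties using (∈-∃++; ∈-++⁺ʳ)
open import Data.List.Relation.Binary.Permutation.Propositional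
  using (_↭_; ↭-refl; ↭-sym; ↭-trans; ↭-reflexive; module PermutationReasoning)
open import Data.List.Relation.Binary.Permutation.Propositional.Properties
  using (↭-empty-inv; ↭-length; ∈-resp-↭; drop-mid; shift; ++⁺ˡ)
open import Data.Product using (∃; ∃₂; ∃-syntax; _×_; _,_; proj₁; proj₂; map₂)
open import Data.Sum using (_⊎_; inj₁; inj₂)
open import Data.Unit using (tt)
open import Relation.Binary.Definitions using (DecidableEquality)
open import Relation.Binary.PropositionalEquality hiding ([_])
open import Relation.Nullary using (¬_; yes; no; does; ¬?)
open import Relation.Nullary.Decidable using (dec-true; dec-false)
open import Relation.Unary using (Decidable)
open import Relation.Unary.Properties using (∁?)

-- Stack sorting

pop-< : ∀ x st o → All (_< x) st → popSmaller x st o ≡ ([] , o ++ st)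
pop-< x []       o []           = cong ([] ,_) (sym (++-identityʳ o))
pop-< x (t ∷ st) o (t<x ∷ st<x) with t <ᵇ x | ℕP.<⇒<ᵇ t<x
... | true  | _ = trans (pop-< x st (o ++ [ t ]) st<x) (cong ([] ,_) (++-assoc o [ t ] st))
... | false | ()

pop-≥ : ∀ x t st o → x ≤ t → popSmaller x (t ∷ st) o ≡ (t ∷ st , o)
pop-≥ x t st o x≤t with t <ᵇ x | ℕP.<ᵇ⇒< t x
... | false | _   = refl
... | true  | t<x = ⊥-elim (ℕP.<⇒≱ (t<x tt) x≤t)

pop-All : ∀ {P : ℕ → Set} x st o → All P st → All P (proj₁ (popSmaller x st o))
pop-All x []       o []        = []
pop-All x (t ∷ st) o (pt ∷ ps) with t <ᵇ x
... | true  = pop-All x st (o ++ [ t ]) ps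
... | false = pt ∷ ps

pop-conserves : ∀ x st o → proj₂ (popSmaller x st o) ++ proj₁ (popSmaller x st o) ≡ o ++ st
pop-conserves x []       o = refl
pop-conserves x (t ∷ st) o with t <ᵇ x
... | true  = trans (pop-conserves x st (o ++ [ t ])) (++-assoc o [ t ] st)
... | false = refl

pop-++ : ∀ x st o o′ → popSmaller x st (o ++ o′) ≡ map₂ (o ++_) (popSmaller x st o′)
pop-++ x []       o o′ = refl
pop-++ x (t ∷ st) o o′ with t <ᵇ x
... | true rewrite ++-assoc o o′ [ t ] = pop-++ x st o (o′ ++ [ t ])
... | false = refl

stackRun-++ : ∀ xs st o o′ → stackRun xs st (o ++ o′) ≡ o ++ stackRun xs st o′
stackRun-++ []       st o o′ = ++-assoc o o′ st
stackRun-++ (x ∷ xs) st o o′ rewrite pop-++ x st o o′ = stackRun-++ xs _ o _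

stackRun-↭ : ∀ xs st o → stackRun xs st o ↭ o ++ st ++ xs
stackRun-↭ []       st o = ↭-reflexive (cong (o ++_) (sym (++-identityʳ st)))
stackRun-↭ (x ∷ xs) st o with popSmaller x st o | pop-conserves x st o
... | st′ , o′ | conserved = begin
  stackRun xs (x ∷ st′) o′  ↭⟨ stackRun-↭ xs (x ∷ st′) o′ ⟩
  o′ ++ x ∷ st′ ++ xs       ↭⟨ ++⁺ˡ o′ (↭-sym (shift x st′ xs)) ⟩
  o′ ++ st′ ++ x ∷ xs       ≡⟨ sym (++-assoc o′ st′ (x ∷ xs)) ⟩
  (o′ ++ st′) ++ x ∷ xs     ≡⟨ cong (_++ x ∷ xs) conserved ⟩
  (o ++ st) ++ x ∷ xs       ≡⟨ ++-assoc o st (x ∷ xs) ⟩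
  o ++ st ++ x ∷ xs         ∎
  where open PermutationReasoning

stackSort-↭ : ∀ xs → stackSort xs ↭ xs
stackSort-↭ xs = stackRun-↭ xs [] []

stackRun-increasing : ∀ {k} B st o → All (_≤ k) st → Linked _<_ (k ∷ B) → stackRun B st o ≡ o ++ st ++ B
stackRun-increasing []      st o _    _ = cong (o ++_) (sym (++-identityʳ st))
stackRun-increasing (b ∷ B) st o st≤k (k<b ∷ b<B)
  rewrite pop-< b st o (All.map (λ t≤k → ℕP.≤-<-trans t≤k k<b) st≤k)
  = trans (stackRun-increasing B [ b ] (o ++ st) (ℕP.≤-refl ∷ []) b<B) (++-assoc o st (b ∷ B))

-- An entry larger than everything before it empties the stack, after which the run starts afresh.
stackRun-flush : ∀ {K} A C st o → All (_< K) A → All (_< K) st →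
                 stackRun (A ++ K ∷ C) st o ≡ stackRun A st o ++ stackRun C [ K ] []
stackRun-flush {K} [] C st o [] st<K rewrite pop-< K st o st<K =
  trans (cong (stackRun C [ K ]) (sym (++-identityʳ (o ++ st)))) (stackRun-++ C [ K ] (o ++ st) [])
stackRun-flush (x ∷ A) C st o (x<K ∷ A<K) st<K with popSmaller x st o | pop-All x st o st<K
... | st′ , o′ | st′<K = stackRun-flush A C (x ∷ st′) o′ A<K (x<K ∷ st′<K)

stackSort-min-∷ : ∀ {p} A → All (p <_) A → stackSort (p ∷ A) ≡ p ∷ stackSort A
stackSort-min-∷         []      _           = refl
stackSort-min-∷ {p} (a ∷ A) (p<a ∷ _) rewrite pop-< a [ p ] [] (p<a ∷ []) = stackRun-++ A [ a ] [ p ] []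

stackRun-below-top : ∀ {m K} B → m ≤ K → Linked _<_ (K ∷ B) → stackRun (m ∷ B) [ K ] [] ≡ m ∷ K ∷ B
stackRun-below-top {m} {K} B m≤K K<B rewrite pop-≥ m K [] [] m≤K =
  stackRun-increasing B (m ∷ K ∷ []) [] (m≤K ∷ ℕP.≤-refl ∷ []) K<B

stackSort-step : ∀ {p K m} A B → All (p <_) A → All (_< K) (p ∷ A) → m ≤ K → Linked _<_ (K ∷ B) →
                 stackSort (p ∷ A ++ K ∷ m ∷ B) ≡ p ∷ stackSort A ++ m ∷ K ∷ B
stackSort-step {p} {K} {m} A B p<A A<K m≤K K<B = begin
  stackRun ((p ∷ A) ++ K ∷ m ∷ B) [] []           ≡⟨ stackRun-flush (p ∷ A) (m ∷ B) [] [] A<K [] ⟩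
  stackSort (p ∷ A) ++ stackRun (m ∷ B) [ K ] []  ≡⟨ cong₂ _++_ (stackSort-min-∷ A p<A) (stackRun-below-top B m≤K K<B) ⟩
  p ∷ stackSort A ++ m ∷ K ∷ B                    ∎
  where open ≡-Reasoning

pop-above-bottom : ∀ x s M o → x ≤ M → ∃₂ λ s′ o′ → popSmaller x (s ∷ʳ M) o ≡ (s′ ∷ʳ M , o′)
pop-above-bottom x []      M o x≤M = [] , o , pop-≥ x M [] o x≤M
pop-above-bottom x (t ∷ s) M o x≤M with t <ᵇ x
... | true  = pop-above-bottom x s M (o ++ [ t ]) x≤M
... | false = t ∷ s , o , refl

stackRun-keeps-bottom : ∀ {M} xs s o → All (_≤ M) xs → ∃ λ Y → stackRun xs (s ∷ʳ M) o ≡ Y ∷ʳ M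
stackRun-keeps-bottom []       s o []            = o ++ s , sym (++-assoc o s _)
stackRun-keeps-bottom {M} (x ∷ xs) s o (x≤M ∷ xs≤M) with pop-above-bottom x s M o x≤M
... | s′ , o′ , popped rewrite popped = stackRun-keeps-bottom xs (x ∷ s′) o′ xs≤M

stackSort-max-last : ∀ {M} A₁ A₂ → All (_< M) A₁ → All (_≤ M) A₂ → ∃ λ Y → stackSort (A₁ ++ M ∷ A₂) ≡ Y ∷ʳ M
stackSort-max-last {M} A₁ A₂ A₁<M A₂≤M with stackRun-keeps-bottom A₂ [] [] A₂≤M
... | Y , kept = stackSort A₁ ++ Y , (begin
  stackRun (A₁ ++ M ∷ A₂) [] []          ≡⟨ stackRun-flush A₁ A₂ [] [] A₁<M [] ⟩
  stackSort A₁ ++ stackRun A₂ [ M ] []   ≡⟨ cong (stackSort A₁ ++_) kept ⟩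
  stackSort A₁ ++ Y ∷ʳ M                 ≡⟨ sym (++-assoc (stackSort A₁) Y [ M ]) ⟩
  (stackSort A₁ ++ Y) ∷ʳ M               ∎)
  where open ≡-Reasoning

range : ℕ → ℕ → List ℕ
range a zero    = []
range a (suc k) = a ∷ range (suc a) k

range-∷ʳ : ∀ a k → range a (suc k) ≡ range a k ∷ʳ (a + k)
range-∷ʳ a zero    = cong [_] (sym (ℕP.+-identityʳ a))
range-∷ʳ a (suc k) = cong (a ∷_) (trans (range-∷ʳ (suc a) k) (cong (range (suc a) k ∷ʳ_) (sym (ℕP.+-suc a k))))

∈-range⁻ : ∀ {x} a k → x ∈ range a k → a ≤ x × x < a + k
∈-range⁻ a (suc k) (here refl) = ℕP.≤-refl , ℕP.m<m+n a (s≤s z≤n)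
∈-range⁻ {x} a (suc k) (there x∈) with ∈-range⁻ (suc a) k x∈
... | a<x , x<a+k = ℕP.<⇒≤ a<x , subst (x <_) (sym (ℕP.+-suc a k)) x<a+k

length-range : ∀ a k → length (range a k) ≡ k
length-range a zero    = refl
length-range a (suc k) = cong suc (length-range (suc a) k)

range-Linked : ∀ k b → Linked _<_ (k ∷ range (suc k) b)
range-Linked k zero    = [-]
range-Linked k (suc b) = ℕP.≤-refl ∷ range-Linked (suc k) b

applyUpTo≡range : ∀ {f} a k → (∀ i → f i ≡ a + i) → applyUpTo f k ≡ range a k
applyUpTo≡range a zero    f≗a+ = refl
applyUpTo≡range a (suc k) f≗a+ =
  cong₂ _∷_ (trans (f≗a+ 0) (ℕP.+-identityʳ a))
            (applyUpTo≡range (suc a) k (λ i → trans (f≗a+ (suc i)) (ℕP.+-suc a i)))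

ident≡range : ∀ n → ident n ≡ range 1 n
ident≡range n = trans (map-upTo suc n) (applyUpTo≡range 1 n (λ _ → refl))

midRange≡range : ∀ k → midRange (3 + k) ≡ range 3 k
midRange≡range k = trans (map-upTo (λ i → 3 + i) k) (applyUpTo≡range 3 k (λ _ → refl))

drop-last : ∀ {x : ℕ} ws zs {xs} → ws ++ [ x ] ++ zs ↭ xs ∷ʳ x → ws ++ zs ↭ xs
drop-last ws zs {xs} p = ↭-trans (drop-mid ws xs p) (↭-reflexive (++-identityʳ xs))

range-top-split : ∀ a k {A} → A ↭ range a (suc k) →
                  ∃₂ λ A₁ A₂ → A ≡ A₁ ++ (a + k) ∷ A₂ × All (_< a + k) (A₁ ++ A₂)
range-top-split a k A↭ with ∈-∃++ (∈-resp-↭ (↭-sym A↭) top∈range)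
  where
  top∈range : a + k ∈ range a (suc k)
  top∈range = subst (a + k ∈_) (sym (range-∷ʳ a k)) (∈-++⁺ʳ (range a k) (here refl))
... | A₁ , A₂ , refl = A₁ , A₂ , refl , All.tabulate (λ x∈ → proj₂ (∈-range⁻ a k (∈-resp-↭ rest↭ x∈)))
  where
  rest↭ : A₁ ++ A₂ ↭ range a k
  rest↭ = drop-last A₁ A₂ (subst (A₁ ++ (a + k) ∷ A₂ ↭_) (range-∷ʳ a k) A↭)

stackSort-range-last : ∀ a k {A} → A ↭ range a (suc k) →
                       ∃ λ A′ → stackSort A ≡ A′ ∷ʳ (a + k) × A′ ↭ range a k
stackSort-range-last a k A↭ with range-top-split a k A↭
... | A₁ , A₂ , refl , rest<M with stackSort-max-last A₁ A₂ (AllP.++⁻ˡ A₁ rest<M) (All.map ℕP.<⇒≤ (AllP.++⁻ʳ A₁ rest<M))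
...   | Y , sorted = Y , sorted , subst (_↭ range a k) (++-identityʳ Y) (drop-last Y [] Y∷ʳM↭)
  where
  Y∷ʳM↭ : Y ∷ʳ (a + k) ↭ range a k ∷ʳ (a + k)
  Y∷ʳM↭ = subst₂ _↭_ sorted (range-∷ʳ a k) (↭-trans (stackSort-↭ _) A↭)

data MaxLast (a : ℕ) : ℕ → List ℕ → Set where
  []      : MaxLast a 0 []
  _∷ʳmax : ∀ {k A} → A ↭ range a k → MaxLast a (suc k) (A ∷ʳ (a + k))

stackSort-MaxLast : ∀ a k {A} → A ↭ range a k → MaxLast a k (stackSort A)
stackSort-MaxLast a zero    A↭ rewrite ↭-empty-inv A↭ = []
stackSort-MaxLast a (suc k) A↭ with stackSort-range-last a k A↭
... | A′ , sorted , A′↭ rewrite sorted = A′↭ ∷ʳmax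

-- The orbit of 2 L n 1

orbitFuel-ident : ∀ n k → orbitFuel n (suc k) (ident n) ≡ [ ident n ]
orbitFuel-ident n k rewrite dec-true (≡-dec _≟_ (ident n) (ident n)) refl = refl

orbitFuel-≢ : ∀ {n k} p → p ≢ ident n → orbitFuel n (suc k) p ≡ p ∷ orbitFuel n k (stackSort p)
orbitFuel-≢ {n} p p≢e rewrite dec-false (≡-dec _≟_ p (ident n)) p≢e = refl

orbitFuel-start : ∀ n k p → p ∈ orbitFuel n k p
orbitFuel-start n zero    p = here refl
orbitFuel-start n (suc k) p with does (≡-dec _≟_ p (ident n))
... | true  = here refl
... | false = here refl

orbitFuel-↭ : ∀ n k p → All (_↭ p) (orbitFuel n k p)
orbitFuel-↭ n zero    p = ↭-refl ∷ []
orbitFuel-↭ n (suc k) p with does (≡-dec _≟_ p (ident n))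
... | true  = ↭-refl ∷ []
... | false = ↭-refl ∷ All.map (λ q↭ → ↭-trans q↭ (stackSort-↭ p)) (orbitFuel-↭ n k (stackSort p))

Starts2Or : List ℕ → List ℕ → Set
Starts2Or u v = v ≡ u ⊎ ∃[ t ] v ≡ 2 ∷ t

stackSort-stage : ∀ j b {A} → A ↭ range 3 j →
  stackSort (2 ∷ (A ∷ʳ (3 + j)) ++ 1 ∷ range (4 + j) b) ≡ 2 ∷ stackSort A ++ 1 ∷ range (3 + j) (suc b)
stackSort-stage j b {A} A↭ rewrite ++-assoc A [ 3 + j ] (1 ∷ range (4 + j) b) =
  stackSort-step A (range (4 + j) b) (All.map proj₁ bounds) (s≤s (s≤s (s≤s z≤n)) ∷ All.map proj₂ bounds)
                 (s≤s z≤n) (range-Linked (3 + j) b)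
  where
  bounds : All (λ x → 3 ≤ x × x < 3 + j) A
  bounds = All.tabulate (λ x∈A → ∈-range⁻ 3 j (∈-resp-↭ A↭ x∈A))

stackSort-2∷1∷range : ∀ b → stackSort (2 ∷ 1 ∷ range 3 b) ≡ ident (2 + b)
stackSort-2∷1∷range b = trans (stackRun-below-top (range 3 b) (s≤s z≤n) (range-Linked 2 b)) (sym (ident≡range (2 + b)))

OrbitShape : ℕ → List (List ℕ) → Set
OrbitShape n O = All (Starts2Or (ident n)) O × ident n ∈ O

2∷≢ident : ∀ n t → 2 ∷ t ≢ ident n
2∷≢ident zero    t ()
2∷≢ident (suc n) t ()

orbitShape-2∷ : ∀ {n k} t → OrbitShape n (orbitFuel n k (stackSort (2 ∷ t))) → OrbitShape n (orbitFuel n (suc k) (2 ∷ t))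
orbitShape-2∷ {n} {k} t (later , e∈) =
  subst (OrbitShape n) (sym (orbitFuel-≢ {k = k} (2 ∷ t) (2∷≢ident n t))) (inj₂ (t , refl) ∷ later , there e∈)

orbit-stage : ∀ {n} j b {A} → MaxLast 3 j A → n ≡ 2 + j + b →
              OrbitShape n (orbitFuel n (2 + j) (2 ∷ A ++ 1 ∷ range (3 + j) b))
orbit-stage {n} zero b [] refl = orbitShape-2∷ {k = 1} (1 ∷ range 3 b)
  (subst (λ q → OrbitShape n (orbitFuel n 1 q)) (sym (stackSort-2∷1∷range b))
    (subst (OrbitShape n) (sym (orbitFuel-ident n 0)) (inj₁ refl ∷ [] , here refl)))
orbit-stage {n} (suc j) b (A↭ ∷ʳmax) refl = orbitShape-2∷ {k = 2 + j} _
  (subst (λ q → OrbitShape n (orbitFuel n (2 + j) q)) (sym (stackSort-stage j b A↭))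
    (orbit-stage j (suc b) (stackSort-MaxLast 3 j A↭) (cong (λ i → 2 + i) (sym (ℕP.+-suc j b)))))

orbit-2Ln1 : ∀ k {L} → L ↭ range 3 k → OrbitShape (3 + k) (orbit (3 + k) (2 ∷ (L ++ (3 + k) ∷ 1 ∷ [])))
orbit-2Ln1 k {L} L↭ =
  subst (λ π → OrbitShape (3 + k) (orbit (3 + k) π)) (cong (2 ∷_) (++-assoc L [ 3 + k ] [ 1 ]))
        (orbit-stage (suc k) 0 (L↭ ∷ʳmax) (sym (ℕP.+-identityʳ (3 + k))))

length-2Ln1 : ∀ k {L} → L ↭ range 3 k → length (2 ∷ (L ++ (3 + k) ∷ 1 ∷ [])) ≡ 3 + k
length-2Ln1 k {L} L↭ = cong suc (begin
  length (L ++ (3 + k) ∷ 1 ∷ [])  ≡⟨ length-++ L ⟩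
  length L + 2                    ≡⟨ cong (λ l → l + 2) (trans (↭-length L↭) (length-range 3 k)) ⟩
  k + 2                           ≡⟨ ℕP.+-comm k 2 ⟩
  2 + k                           ∎)
  where open ≡-Reasoning

gcd[i,1]≡1 : ∀ i → gcdℤ i (+ 1) ≡ + 1
gcd[i,1]≡1 i = cong +_ (gcd-zeroʳ ℤ.∣ i ∣)

↥-ℤtoℚ : ∀ i → ↥ (ℤtoℚ i) ≡ i
↥-ℤtoℚ i = begin
  ↥ (ℤtoℚ i)                    ≡⟨ sym (ℤP.*-identityʳ _) ⟩
  ↥ (ℤtoℚ i) ℤ.* + 1            ≡⟨ cong (↥ (ℤtoℚ i) ℤ.*_) (sym (gcd[i,1]≡1 i)) ⟩
  ↥ (ℤtoℚ i) ℤ.* gcdℤ i (+ 1)   ≡⟨ ℚP.↥-/ i 1 ⟩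
  i                             ∎
  where open ≡-Reasoning

↧-ℤtoℚ : ∀ i → ↧ (ℤtoℚ i) ≡ + 1
↧-ℤtoℚ i = begin
  ↧ (ℤtoℚ i)                    ≡⟨ sym (ℤP.*-identityʳ _) ⟩
  ↧ (ℤtoℚ i) ℤ.* + 1            ≡⟨ cong (↧ (ℤtoℚ i) ℤ.*_) (sym (gcd[i,1]≡1 i)) ⟩
  ↧ (ℤtoℚ i) ℤ.* gcdℤ i (+ 1)   ≡⟨ ℚP.↧-/ i 1 ⟩
  + 1                           ∎
  where open ≡-Reasoning

↥ℤtoℚ*↧ℤtoℚ : ∀ i j → ↥ (ℤtoℚ i) ℤ.* ↧ (ℤtoℚ j) ≡ i
↥ℤtoℚ*↧ℤtoℚ i j = trans (cong₂ ℤ._*_ (↥-ℤtoℚ i) (↧-ℤtoℚ j)) (ℤP.*-identityʳ i)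

ℤtoℚ-injective : ∀ {i j} → ℤtoℚ i ≡ ℤtoℚ j → i ≡ j
ℤtoℚ-injective {i} {j} eq = trans (sym (↥-ℤtoℚ i)) (trans (cong ↥_ eq) (↥-ℤtoℚ j))

ℤtoℚ-cancel-< : ∀ {i j} → ℤtoℚ i ℚ.< ℤtoℚ j → i ℤ.< j
ℤtoℚ-cancel-< {i} {j} i<j = subst₂ ℤ._<_ (↥ℤtoℚ*↧ℤtoℚ i j) (↥ℤtoℚ*↧ℤtoℚ j i) (ℚP.drop-*<* i<j)

ℤtoℚ-cancel-≤ : ∀ {i j} → ℤtoℚ i ℚ.≤ ℤtoℚ j → i ℤ.≤ j
ℤtoℚ-cancel-≤ {i} {j} i≤j = subst₂ ℤ._≤_ (↥ℤtoℚ*↧ℤtoℚ i j) (↥ℤtoℚ*↧ℤtoℚ j i) (ℚP.drop-*≤* i≤j)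

no-integer-strictly-between-1-2 : ∀ i → 1ℚ ℚ.< ℤtoℚ i → ℤtoℚ i ℚ.< 1ℚ ℚ.+ 1ℚ → ⊥
no-integer-strictly-between-1-2 i 1<i i<2 with ℤtoℚ-cancel-< {+ 1} {i} 1<i | ℤtoℚ-cancel-< {i} {+ 2} i<2
... | +<+ (s≤s (s≤s _)) | +<+ (s≤s (s≤s ()))

integer-between-1-2 : ∀ i → 1ℚ ℚ.≤ ℤtoℚ i → ℤtoℚ i ℚ.≤ 1ℚ ℚ.+ 1ℚ → i ≡ + 1 ⊎ i ≡ + 2
integer-between-1-2 i 1≤i i≤2 = cases i (ℤtoℚ-cancel-≤ {+ 1} 1≤i) (ℤtoℚ-cancel-≤ {j = + 2} i≤2)
  where
  cases : ∀ i → + 1 ℤ.≤ i → i ℤ.≤ + 2 → i ≡ + 1 ⊎ i ≡ + 2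
  cases (+ 1)                  _         _                     = inj₁ refl
  cases (+ 2)                  _         _                     = inj₂ refl
  cases (+ 0)                  (+≤+ ())  _
  cases (+ suc (suc (suc _)))  _         (+≤+ (s≤s (s≤s ())))
  cases -[1+ _ ]               ()        _

total : List ℚ → ℚ
total = foldr ℚ._+_ 0ℚ

weightOn : {P : List ℕ → Set} → Decidable P → List ℚ → List (List ℕ) → ℚ
weightOn P? (w ∷ ws) (v ∷ vs) = if does (P? v) then w ℚ.+ weightOn P? ws vs else weightOn P? ws vs
weightOn P? _        _        = 0ℚ

nonneg-+-≡0 : ∀ {a b} → 0ℚ ℚ.≤ a → 0ℚ ℚ.≤ b → a ℚ.+ b ≡ 0ℚ → a ≡ 0ℚ × b ≡ 0ℚ
nonneg-+-≡0 {a} {b} 0≤a 0≤b a+b≡0 = ℚP.≤-antisym a≤0 0≤a , ℚP.≤-antisym b≤0 0≤b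
  where
  open ℚP.≤-Reasoning
  a≤0 : a ℚ.≤ 0ℚ
  a≤0 = begin
    a          ≡⟨ sym (ℚP.+-identityʳ a) ⟩
    a ℚ.+ 0ℚ   ≤⟨ ℚP.+-monoʳ-≤ a 0≤b ⟩
    a ℚ.+ b    ≡⟨ a+b≡0 ⟩
    0ℚ         ∎
  b≤0 : b ℚ.≤ 0ℚ
  b≤0 = begin
    b          ≡⟨ sym (ℚP.+-identityˡ b) ⟩
    0ℚ ℚ.+ b   ≤⟨ ℚP.+-monoˡ-≤ b 0≤a ⟩
    a ℚ.+ b    ≡⟨ a+b≡0 ⟩
    0ℚ         ∎

module _ {P : List ℕ → Set} (P? : Decidable P) where

  weightOn-split : ∀ ws vs → length ws ≡ length vs → total ws ≡ weightOn P? ws vs ℚ.+ weightOn (∁? P?) ws vs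
  weightOn-split []       []       _   = refl
  weightOn-split (w ∷ ws) (v ∷ vs) len with P? v | weightOn-split ws vs (ℕP.suc-injective len)
  ... | yes _ | split = trans (cong (w ℚ.+_) split) (sym (ℚP.+-assoc w _ _))
  ... | no  _ | split = trans (cong (w ℚ.+_) split) (swap w (weightOn P? ws vs) (weightOn (∁? P?) ws vs))
    where
    open +-*-Solver
    swap : ∀ x y z → x ℚ.+ (y ℚ.+ z) ≡ y ℚ.+ (x ℚ.+ z)
    swap = solve 3 (λ x y z → x :+ (y :+ z) := y :+ (x :+ z)) refl

  weightOn-∷-no : ∀ w ws {v} vs → ¬ P v → weightOn P? (w ∷ ws) (v ∷ vs) ≡ weightOn P? ws vs
  weightOn-∷-no w ws {v} vs ¬Pv rewrite dec-false (P? v) ¬Pv = refl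

  weightOn-nonneg : ∀ ws vs → All (0ℚ ℚ.≤_) ws → 0ℚ ℚ.≤ weightOn P? ws vs
  weightOn-nonneg []       _        _            = ℚP.≤-refl
  weightOn-nonneg (w ∷ ws) []       _            = ℚP.≤-refl
  weightOn-nonneg (w ∷ ws) (v ∷ vs) (0≤w ∷ 0≤ws) with does (P? v)
  ... | true  = ℚP.+-mono-≤ 0≤w (weightOn-nonneg ws vs 0≤ws)
  ... | false = weightOn-nonneg ws vs 0≤ws

  weightOn-pos : ∀ ws vs → length ws ≡ length vs → All (0ℚ ℚ.<_) ws → Any P vs → 0ℚ ℚ.< weightOn P? ws vs
  weightOn-pos (w ∷ ws) (v ∷ vs) len (0<w ∷ 0<ws) P∈vs with P? v | P∈vs
  ... | yes _  | _            = ℚP.+-mono-<-≤ 0<w (weightOn-nonneg ws vs (All.map ℚP.<⇒≤ 0<ws))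
  ... | no ¬Pv | here Pv      = ⊥-elim (¬Pv Pv)
  ... | no _   | there P∈vs′  = weightOn-pos ws vs (ℕP.suc-injective len) 0<ws P∈vs′

  weightOn-≡0 : ∀ ws vs → length ws ≡ length vs → All (0ℚ ℚ.≤_) ws → weightOn P? ws vs ≡ 0ℚ →
                Pointwise (λ w v → P v → w ≡ 0ℚ) ws vs
  weightOn-≡0 []       []       _   _            _  = []
  weightOn-≡0 (w ∷ ws) (v ∷ vs) len (0≤w ∷ 0≤ws) ≡0 with P? v
  ... | yes _ =
    let w≡0 , rest≡0 = nonneg-+-≡0 0≤w (weightOn-nonneg ws vs 0≤ws) ≡0
    in (λ _ → w≡0) ∷ weightOn-≡0 ws vs (ℕP.suc-injective len) 0≤ws rest≡0
  ... | no ¬Pv = (λ Pv → ⊥-elim (¬Pv Pv)) ∷ weightOn-≡0 ws vs (ℕP.suc-injective len) 0≤ws ≡0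

scale : ℚ → List ℕ → List ℚ
scale w v = map (λ k → w ℚ.* ℕtoℚ k) v

length-combo : ∀ n ws vs → All (λ v → length v ≡ n) vs → length (combo n ws vs) ≡ n
length-combo n []       _        _           = length-replicate n
length-combo n (w ∷ ws) []       _           = length-replicate n
length-combo n (w ∷ ws) (v ∷ vs) (lv ∷ lvs) = begin
  length (zipWith ℚ._+_ (scale w v) (combo n ws vs))  ≡⟨ length-zipWith ℚ._+_ (scale w v) _ ⟩
  length (scale w v) ℕ.⊓ length (combo n ws vs)        ≡⟨ cong₂ ℕ._⊓_ (trans (length-map _ v) lv) (length-combo n ws vs lvs) ⟩
  n ℕ.⊓ n                                              ≡⟨ ℕP.⊓-idem n ⟩
  n                                                    ∎
  where open ≡-Reasoning

zipWith-scale-0 : ∀ v acc → length v ≡ length acc → zipWith ℚ._+_ (scale 0ℚ v) acc ≡ acc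
zipWith-scale-0 []      []         _   = refl
zipWith-scale-0 (k ∷ v) (a ∷ acc) len =
  cong₂ _∷_ (trans (cong (ℚ._+ a) (ℚP.*-zeroˡ (ℕtoℚ k))) (ℚP.+-identityˡ a))
            (zipWith-scale-0 v acc (ℕP.suc-injective len))

zipWith-scale : ∀ w w′ u → zipWith ℚ._+_ (scale w u) (scale w′ u) ≡ scale (w ℚ.+ w′) u
zipWith-scale w w′ []      = refl
zipWith-scale w w′ (k ∷ u) = cong₂ _∷_ (sym (ℚP.*-distribʳ-+ (ℕtoℚ k) w w′)) (zipWith-scale w w′ u)

replicate≡scale-0 : ∀ u → replicate (length u) 0ℚ ≡ scale 0ℚ u
replicate≡scale-0 []      = refl
replicate≡scale-0 (k ∷ u) = cong₂ _∷_ (sym (ℚP.*-zeroˡ (ℕtoℚ k))) (replicate≡scale-0 u)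

combo-filter : ∀ {P : List ℕ → Set} (P? : Decidable P) {Q : ℚ → Set} n ws vs →
  Pointwise (λ w v → P v → w ≡ 0ℚ) ws vs → All (λ v → length v ≡ n) vs → All Q ws →
  ∃[ ws′ ] length ws′ ≡ length (filter (∁? P?) vs) × All Q ws′ × total ws′ ≡ total ws
           × combo n ws′ (filter (∁? P?) vs) ≡ combo n ws vs
combo-filter P? n []       []       []               _          _          = [] , refl , [] , refl , refl
combo-filter P? n (w ∷ ws) (v ∷ vs) (Pv⇒w≡0 ∷ vanish) (lv ∷ lvs) (Qw ∷ Qws)
  with combo-filter P? n ws vs vanish lvs Qws
... | ws′ , len , Qws′ , tot , comb with P? v
...   | no _  = w ∷ ws′ , cong suc len , Qw ∷ Qws′ , cong (w ℚ.+_) tot , cong (zipWith ℚ._+_ (scale w v)) comb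
...   | yes Pv rewrite Pv⇒w≡0 Pv =
  ws′ , len , Qws′ , trans tot (sym (ℚP.+-identityˡ (total ws))) ,
  trans comb (sym (zipWith-scale-0 v _ (trans lv (sym (length-combo n ws vs lvs)))))

combo-concentrated : ∀ n u ws vs → length u ≡ n → Pointwise (λ w v → v ≢ u → w ≡ 0ℚ) ws vs →
                     All (λ v → length v ≡ n) vs → combo n ws vs ≡ scale (total ws) u
combo-concentrated n u []       []       refl []                _          = replicate≡scale-0 u
combo-concentrated n u (w ∷ ws) (v ∷ vs) lu   (v≢u⇒w≡0 ∷ vanish) (lv ∷ lvs)
  with combo-concentrated n u ws vs lu vanish lvs | ≡-dec _≟_ v u
... | rest | yes refl = trans (cong (zipWith ℚ._+_ (scale w v)) rest) (zipWith-scale w (total ws) u)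
... | rest | no v≢u rewrite v≢u⇒w≡0 v≢u = begin
  zipWith ℚ._+_ (scale 0ℚ v) (combo n ws vs)  ≡⟨ zipWith-scale-0 v _ (trans lv (sym (length-combo n ws vs lvs))) ⟩
  combo n ws vs                              ≡⟨ rest ⟩
  scale (total ws) u                         ≡⟨ cong (λ c → scale c u) (sym (ℚP.+-identityˡ (total ws))) ⟩
  scale (0ℚ ℚ.+ total ws) u                  ∎
  where open ≡-Reasoning

-- Simplices with one vertex at first coordinate 1 and all others at 2

_≟ᵥ_ : DecidableEquality (List ℕ)
_≟ᵥ_ = ≡-dec _≟_

combo-head : ∀ m t₀ ws vs → length ws ≡ length vs → All (Starts2Or (1 ∷ t₀)) vs →
  ∃[ rest ] combo (suc m) ws vs ≡ (total ws ℚ.+ weightOn (∁? (_≟ᵥ (1 ∷ t₀))) ws vs) ∷ rest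
combo-head m t₀ []       []       _   []          = _ , refl
combo-head m t₀ (w ∷ ws) (v ∷ vs) len (inj₁ refl ∷ lvs) with combo-head m t₀ ws vs (ℕP.suc-injective len) lvs
... | rest , head≡ =
  _ , trans (cong (zipWith ℚ._+_ (scale w v)) head≡) (cong (_∷ _) (trans (at-u w _ _) (cong (w ℚ.+ total ws ℚ.+_) off-u)))
  where
  open +-*-Solver
  at-u : ∀ w T E → w ℚ.* ℕtoℚ 1 ℚ.+ (T ℚ.+ E) ≡ (w ℚ.+ T) ℚ.+ E
  at-u = solve 3 (λ w T E → w :* con 1ℚ :+ (T :+ E) := (w :+ T) :+ E) refl
  off-u : weightOn (∁? (_≟ᵥ v)) ws vs ≡ weightOn (∁? (_≟ᵥ v)) (w ∷ ws) (v ∷ vs)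
  off-u = sym (weightOn-∷-no (∁? (_≟ᵥ v)) w ws vs (λ v≢v → v≢v refl))
combo-head m t₀ (w ∷ ws) (v ∷ vs) len (inj₂ (t , refl) ∷ lvs) with combo-head m t₀ ws vs (ℕP.suc-injective len) lvs
... | rest , head≡ = _ , trans (cong (zipWith ℚ._+_ (scale w v)) head≡) (cong (_∷ _) (at-2 w _ _))
  where
  open +-*-Solver
  at-2 : ∀ w T E → w ℚ.* ℕtoℚ 2 ℚ.+ (T ℚ.+ E) ≡ (w ℚ.+ T) ℚ.+ (w ℚ.+ E)
  at-2 = solve 3 (λ w T E → w :* (con 1ℚ :+ con 1ℚ) :+ (T :+ E) := (w :+ T) :+ (w :+ E)) refl

module TwoLevels {m : ℕ} {t₀ : List ℕ} {S : List (List ℕ)}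
                 (levels : All (Starts2Or (1 ∷ t₀)) S) (u∈S : 1 ∷ t₀ ∈ S) where

  u : List ℕ
  u = 1 ∷ t₀

  weightAt-u weightOff-u : List ℚ → ℚ
  weightAt-u  ws = weightOn (_≟ᵥ u) ws S
  weightOff-u ws = weightOn (∁? (_≟ᵥ u)) ws S

  weights-sum : ∀ ws → length ws ≡ length S → total ws ≡ 1ℚ → weightAt-u ws ℚ.+ weightOff-u ws ≡ 1ℚ
  weights-sum ws len tot = trans (sym (weightOn-split (_≟ᵥ u) ws S len)) tot

  weightOff-u<1 : ∀ ws → length ws ≡ length S → total ws ≡ 1ℚ → 0ℚ ℚ.< weightAt-u ws → weightOff-u ws ℚ.< 1ℚ
  weightOff-u<1 ws len tot 0<at-u = begin-strict
    weightOff-u ws                        ≡⟨ sym (ℚP.+-identityˡ _) ⟩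
    0ℚ ℚ.+ weightOff-u ws                 <⟨ ℚP.+-monoˡ-< (weightOff-u ws) 0<at-u ⟩
    weightAt-u ws ℚ.+ weightOff-u ws      ≡⟨ weights-sum ws len tot ⟩
    1ℚ                                    ∎
    where open ℚP.≤-Reasoning

  weightOff-u≤1 : ∀ ws → length ws ≡ length S → total ws ≡ 1ℚ → All (0ℚ ℚ.≤_) ws → weightOff-u ws ℚ.≤ 1ℚ
  weightOff-u≤1 ws len tot 0≤ws = begin
    weightOff-u ws                        ≡⟨ sym (ℚP.+-identityˡ _) ⟩
    0ℚ ℚ.+ weightOff-u ws                 ≤⟨ ℚP.+-monoˡ-≤ (weightOff-u ws) (weightOn-nonneg (_≟ᵥ u) ws S 0≤ws) ⟩
    weightAt-u ws ℚ.+ weightOff-u ws      ≡⟨ weights-sum ws len tot ⟩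
    1ℚ                                    ∎
    where open ℚP.≤-Reasoning

  first-coordinate : ∀ ws {x} → length ws ≡ length S → total ws ≡ 1ℚ → combo (suc m) ws S ≡ latt x →
                     ∃[ x₁ ] ℤtoℚ x₁ ≡ 1ℚ ℚ.+ weightOff-u ws
  first-coordinate ws {x} len tot c with combo-head m t₀ ws S len levels
  ... | rest , head≡ with x | trans (sym head≡) c
  ...   | x₁ ∷ _ | c′ = x₁ , trans (sym (∷-injectiveˡ c′)) (cong (ℚ._+ weightOff-u ws) tot)

  no-lattice-point-in-relint : Any (_≢ u) S → (x : List ℤ) → ¬ InRelInt (suc m) S (latt x)
  no-lattice-point-in-relint other x (ws , len , 0<ws , tot , c) with first-coordinate ws len tot c
  ... | x₁ , x₁≡ = no-integer-strictly-between-1-2 x₁ 1<x₁ x₁<2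
    where
    open ℚP.≤-Reasoning
    1<x₁ : 1ℚ ℚ.< ℤtoℚ x₁
    1<x₁ = begin-strict
      1ℚ                       <⟨ ℚP.+-monoʳ-< 1ℚ (weightOn-pos (∁? (_≟ᵥ u)) ws S len 0<ws other) ⟩
      1ℚ ℚ.+ weightOff-u ws    ≡⟨ sym x₁≡ ⟩
      ℤtoℚ x₁                  ∎
    x₁<2 : ℤtoℚ x₁ ℚ.< 1ℚ ℚ.+ 1ℚ
    x₁<2 = begin-strict
      ℤtoℚ x₁                  ≡⟨ x₁≡ ⟩
      1ℚ ℚ.+ weightOff-u ws    <⟨ ℚP.+-monoʳ-< 1ℚ (weightOff-u<1 ws len tot (weightOn-pos (_≟ᵥ u) ws S len 0<ws (Any.map sym u∈S))) ⟩
      1ℚ ℚ.+ 1ℚ                ∎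

  lattice-point-on-facet : All (λ v → length v ≡ suc m) S → (x : List ℤ) → InConv (suc m) S (latt x) →
    ((v : List ℕ) → v ∈ S → map +_ v ≢ x) → InConv (suc m) (filter (∁? (_≟ᵥ u)) S) (latt x)
  lattice-point-on-facet dims x (ws , len , 0≤ws , tot , c) x∉S with first-coordinate ws len tot c
  -- In the two cases below, ℤtoℚ (+ 1) computes to 1ℚ ℚ.+ 0ℚ and ℤtoℚ (+ 2) to 1ℚ ℚ.+ 1ℚ.
  ... | x₁ , x₁≡ with integer-between-1-2 x₁ 1≤x₁ x₁≤2
    where
    open ℚP.≤-Reasoning
    1≤x₁ : 1ℚ ℚ.≤ ℤtoℚ x₁
    1≤x₁ = begin
      1ℚ                       ≤⟨ ℚP.+-monoʳ-≤ 1ℚ (weightOn-nonneg (∁? (_≟ᵥ u)) ws S 0≤ws) ⟩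
      1ℚ ℚ.+ weightOff-u ws    ≡⟨ sym x₁≡ ⟩
      ℤtoℚ x₁                  ∎
    x₁≤2 : ℤtoℚ x₁ ℚ.≤ 1ℚ ℚ.+ 1ℚ
    x₁≤2 = begin
      ℤtoℚ x₁                  ≡⟨ x₁≡ ⟩
      1ℚ ℚ.+ weightOff-u ws    ≤⟨ ℚP.+-monoʳ-≤ 1ℚ (weightOff-u≤1 ws len tot 0≤ws) ⟩
      1ℚ ℚ.+ 1ℚ                ∎
  ... | inj₁ refl = ⊥-elim (x∉S u u∈S (sym x≡u))
    where
    weights-at-u : combo (suc m) ws S ≡ scale (total ws) u
    weights-at-u = combo-concentrated (suc m) u ws S (All.lookup dims u∈S)
      (weightOn-≡0 (∁? (_≟ᵥ u)) ws S len 0≤ws (sym (∙-cancelˡ 1ℚ 0ℚ _ x₁≡))) dims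
    x≡u : x ≡ map +_ u
    x≡u = map-injective ℤtoℚ-injective (begin
      latt x               ≡⟨ sym c ⟩
      combo (suc m) ws S   ≡⟨ weights-at-u ⟩
      scale (total ws) u   ≡⟨ cong (λ t → scale t u) tot ⟩
      scale 1ℚ u           ≡⟨ map-cong (λ k → ℚP.*-identityˡ (ℕtoℚ k)) u ⟩
      map ℕtoℚ u           ≡⟨ map-∘ u ⟩
      latt (map +_ u)      ∎)
      where open ≡-Reasoning
  ... | inj₂ refl with combo-filter (_≟ᵥ u) (suc m) ws S (weightOn-≡0 (_≟ᵥ u) ws S len 0≤ws no-weight-at-u) dims 0≤ws
    where
    weightOff-u≡1 : weightOff-u ws ≡ 1ℚ
    weightOff-u≡1 = sym (∙-cancelˡ 1ℚ 1ℚ _ x₁≡)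
    no-weight-at-u : weightAt-u ws ≡ 0ℚ
    no-weight-at-u = ∙-cancelʳ 1ℚ _ 0ℚ (trans (cong (weightAt-u ws ℚ.+_) (sym weightOff-u≡1)) (weights-sum ws len tot))
  ... | ws′ , len′ , 0≤ws′ , tot′ , c′ = ws′ , len′ , 0≤ws′ , trans tot′ tot , trans c′ c

proposition5p2 : (n : ℕ) → 3 ≤ n → (L : List ℕ) → L ↭ midRange n →
    let π = 2 ∷ (L ++ (n ∷ 1 ∷ []))
        S = orbit n π
    in ((x : List ℤ) → ¬ InRelInt n S (latt x))
       × ((x : List ℤ) → InConv n S (latt x) → ((v : List ℕ) → v ∈ S → map +_ v ≢ x) →
          InConv n (filter (λ v → ¬? (≡-dec _≟_ v (ident n))) S) (latt x))
proposition5p2 (suc (suc (suc k))) (s≤s (s≤s (s≤s z≤n))) L L↭mid =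
  TwoLevels.no-lattice-point-in-relint levels e∈S π≢e∈S , TwoLevels.lattice-point-on-facet levels e∈S dims
  where
  n = 3 + k
  π = 2 ∷ (L ++ n ∷ 1 ∷ [])
  L↭ : L ↭ range 3 k
  L↭ = subst (L ↭_) (midRange≡range k) L↭mid
  levels : All (Starts2Or (ident n)) (orbit n π)
  levels = proj₁ (orbit-2Ln1 k L↭)
  e∈S : ident n ∈ orbit n π
  e∈S = proj₂ (orbit-2Ln1 k L↭)
  π≢e∈S : Any (_≢ ident n) (orbit n π)
  π≢e∈S = Any.map (λ π≡v → subst (_≢ ident n) π≡v (2∷≢ident n _)) (orbitFuel-start n n π)
  dims : All (λ v → length v ≡ n) (orbit n π)
  dims = All.map (λ v↭π → trans (↭-length v↭π) (length-2Ln1 k L↭)) (orbitFuel-↭ n n π)
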